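{- Let $G$ be a clique tree with blocks $B_1,B_2,\dots,B_b$, where each block has at least $3$ vertices. Then $$Z(G) = \sum_{i=1}^{b} Z(B_i) - \sum_{v\in V(G)} \bigl(bi_G(v)-1\bigr).$$
   Context: A block of a graph is a maximal connected subgraph without a cut vertex; a clique tree is a connected graph each of whose blocks is a complete graph. For a vertex $v$, the block index $bi_G(v)$ is the number of blocks of $G$ containing $v$. Zero forcing: color each vertex blue or white; if a blue vertex $u$ has exactly one white neighbor $v$, then $v$ becomes blue. A set $S$ is a zero forcing set if, starting with exactly $S$ blue, repeated application of this rule makes all vertices blue; $Z(G)$ is the minimum size of a zero forcing set. -}

module Defs where

open import Data.Nat using (ℕ; zero; suc; _+_; _∸_; _≤_)
open import Data.Bool using (Bool; true; false; if_then_else_)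
open import Data.Fin using (Fin; zero; suc)
open import Data.Fin.Subset using (Subset; _∈_; _⊂_; _-_; ∣_∣; ⊤)
open import Data.Vec using (lookup)
open import Data.Product using (_×_; ∃; _,_)
open import Relation.Binary.PropositionalEquality using (_≡_)
open import Relation.Nullary using (¬_)
open import Relation.Binary.Construct.Closure.ReflexiveTransitive using (Star)

record Graph (n : ℕ) : Set₁ where
  field
    Adj     : Fin n → Fin n → Set
    symAdj  : ∀ {u v} → Adj u v → Adj v u
    irrAdj  : ∀ {u} → ¬ Adj u u
open Graph public

Σ[_] : (b : ℕ) → (Fin b → ℕ) → ℕ
Σ[ zero  ] f = 0
Σ[ suc b ] f = f zero + Σ[ b ] (λ i → f (suc i))

AdjIn : ∀ {n} → Graph n → Subset n → Fin n → Fin n → Set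
AdjIn G W x y = x ∈ W × y ∈ W × Adj G x y

-- The induced subgraph G[W] is connected (any two of its vertices are
-- joined by a path in G[W]; the empty graph counts as connected).
Connected : ∀ {n} → Graph n → Subset n → Set
Connected G W = ∀ u v → u ∈ W → v ∈ W → Star (AdjIn G W) u v

Nonseparable : ∀ {n} → Graph n → Subset n → Set
Nonseparable G W = Connected G W × (∀ v → v ∈ W → Connected G (W - v))

IsBlock : ∀ {n} → Graph n → Subset n → Set
IsBlock G W = Nonseparable G W × (∀ W' → W ⊂ W' → ¬ Nonseparable G W')

Complete : ∀ {n} → Graph n → Subset n → Set
Complete G W = ∀ u v → u ∈ W → v ∈ W → ¬ u ≡ v → Adj G u v

IsCliqueTree : ∀ {n} → Graph n → Set
IsCliqueTree G = Connected G ⊤ × (∀ W → IsBlock G W → Complete G W)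

BlocksOf : ∀ {n b} → Graph n → (Fin b → Subset n) → Set
BlocksOf {b = b} G Bs =
  (∀ i → IsBlock G (Bs i)) ×
  (∀ i j → Bs i ≡ Bs j → i ≡ j) ×
  (∀ W → IsBlock G W → ∃ λ i → Bs i ≡ W)

blockIndex : ∀ {n b} → (Fin b → Subset n) → Fin n → ℕ
blockIndex {b = b} Bs v = Σ[ b ] (λ i → if lookup (Bs i) v then 1 else 0)

data Blue {n} (G : Graph n) (W S : Subset n) : Fin n → Set where
  initial : ∀ {v} → v ∈ S → Blue G W S v
  force   : ∀ {u v} → Blue G W S u → AdjIn G W u v →
            (∀ w → AdjIn G W u w → ¬ w ≡ v → Blue G W S w) →
            Blue G W S v

IsZFS : ∀ {n} → Graph n → Subset n → Subset n → Set
IsZFS G W S = (∀ {x} → x ∈ S → x ∈ W) × (∀ v → v ∈ W → Blue G W S v)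

IsZ : ∀ {n} → Graph n → Subset n → ℕ → Set
IsZ G W k = (∃ λ S → IsZFS G W S × ∣ S ∣ ≡ k) ×
            (∀ S → IsZFS G W S → k ≤ ∣ S ∣)

-- Z(G) = n − b; the formula then follows from Z(Bᵢ) = |Bᵢ| − 1 for a clique and from
-- Σᵥ bi(v) = Σᵢ |Bᵢ|.
-- Lower bound: the blocks are cliques covering every edge. Run the forcing in rounds. When a
-- clique sees its first force, all of it except the forced vertex is already blue, so each
-- clique hosts the first force of at most one vertex, and at most b vertices get forced.
-- Upper bound: root G at r and call the vertex of a block nearest to r its anchor. Every other
-- vertex is a non-anchor of exactly one block, one level below its anchor; this is where the
-- tree structure enters, through chords of cycles. Colour everything blue except one
-- non-anchor per block. A second non-anchor of the block forces it as soon as the blocks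
-- hanging from that vertex are done, by induction from the leaves.

module Submission where

open import Defs
open import Data.Bool using (Bool; if_then_else_)
open import Data.Empty using (⊥-elim)
open import Data.Fin using (Fin; zero; suc; punchOut)
open import Data.Fin.Properties using (punchOut-injective; any?; all?)
import Data.Fin.Properties as Fin
open import Data.Fin.Subset using (Subset; ∁; _∈_; _∉_; _⊆_; _⊂_; ⊤; _-_; _─_; ∣_∣; ⁅_⁆; _∪_; ⊥; inside; outside; Nonempty)
open import Data.Fin.Subset.Properties using (_∈?_; _⊆?_; nonempty?; ∈⊤; ∉⊥; x∈⁅x⁆; x∈⁅y⁆⇒x≡y; x∈p∪q⁻; x∈p∪q⁺; x∈∁p⇒x∉p; x∉p⇒x∈∁p; x∈p∧x≢y⇒x∈p-y; p─⊥≡p; p─q⊆p; ⊆-reflexive; ⊆-antisym; ⊆-trans; p⊆p∪q; q⊆p∪q; ∣p∣≤n; p⊆q⇒∣p∣≤∣q∣; p⊂q⇒∣p∣<∣q∣; x∈p⇒∣p-x∣<∣p∣; ∣∁p∣≡n∸∣p∣)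
open import Data.List using (List; []; _∷_)
import Data.List as List
open import Data.List.Membership.Propositional using () renaming (_∈_ to _∈ˡ_; _∉_ to _∉ˡ_)
open import Data.List.Membership.Propositional.Properties using (∈-tabulate⁺; ∈-tabulate⁻)
import Data.List.Relation.Unary.All as All
open import Data.List.Relation.Unary.All.Properties using (¬Any⇒All¬)
open import Data.List.Relation.Unary.AllPairs using (AllPairs; []; _∷_)
open import Data.List.Relation.Unary.Any using (here; there)
import Data.List.Relation.Unary.Any as Any
open import Data.List.Relation.Unary.Unique.Propositional using (Unique)
open import Data.Nat using (ℕ; zero; suc; _+_; _*_; _∸_; _≤_; _<_; z≤n; s≤s; _≤′_; ≤′-refl; ≤′-step)
open import Data.Nat.Induction using (<-wellFounded)
open import Data.Nat.Properties
open import Algebra.Properties.CommutativeSemigroup +-commutativeSemigroup using (interchange; xy∙z≈y∙xz)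
open import Data.Product using (Σ; _×_; ∃; ∃₂; _,_; proj₁; proj₂)
open import Data.Sum using (_⊎_; inj₁; inj₂)
import Data.Sum as Sum
open import Data.Vec using ([]; _∷_; lookup; here; there)
open import Data.Vec.Properties using ([]=⇒lookup)
open import Function using (_∘_; _$_; id; case_of_; _⟨_⟩_)
open import Induction.WellFounded using (Acc; acc)
open import Relation.Binary.Construct.Closure.ReflexiveTransitive using (Star; ε; _◅_; _◅◅_; gmap; reverse)
open import Relation.Binary.PropositionalEquality
open import Relation.Nullary using (¬_; Dec; yes; no)
open import Relation.Nullary.Decidable using (_×-dec_; _⊎-dec_; _→-dec_; ¬?; decidable-stable)
open import Relation.Unary using (Decidable)

Σ-cong : ∀ {k} {f g : Fin k → ℕ} → (∀ x → f x ≡ g x) → Σ[ k ] f ≡ Σ[ k ] g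
Σ-cong {zero}  f≡g = refl
Σ-cong {suc k} f≡g = cong₂ _+_ (f≡g zero) (Σ-cong (f≡g ∘ suc))

Σ-distrib-+ : ∀ {k} (f g : Fin k → ℕ) → Σ[ k ] (λ x → f x + g x) ≡ Σ[ k ] f + Σ[ k ] g
Σ-distrib-+ {zero}  f g = refl
Σ-distrib-+ {suc k} f g =
  trans (cong (f zero + g zero +_) (Σ-distrib-+ (f ∘ suc) (g ∘ suc))) (interchange (f zero) (g zero) _ _)

Σ-const : ∀ k c → Σ[ k ] (λ _ → c) ≡ k * c
Σ-const zero    c = refl
Σ-const (suc k) c = cong (c +_) (Σ-const k c)

Σ-comm : ∀ {k m} (f : Fin k → Fin m → ℕ) →
  Σ[ k ] (λ x → Σ[ m ] (f x)) ≡ Σ[ m ] (λ y → Σ[ k ] (λ x → f x y))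
Σ-comm {zero}  {m} f = trans (sym (*-zeroʳ m)) (sym (Σ-const m 0))
Σ-comm {suc k} {m} f = begin
  Σ[ m ] (f zero) + Σ[ k ] (λ x → Σ[ m ] (f (suc x)))
    ≡⟨ cong (Σ[ m ] (f zero) +_) (Σ-comm (f ∘ suc)) ⟩
  Σ[ m ] (f zero) + Σ[ m ] (λ y → Σ[ k ] (λ x → f (suc x) y))
    ≡⟨ Σ-distrib-+ (f zero) _ ⟨
  Σ[ m ] (λ y → Σ[ suc k ] (λ x → f x y)) ∎
  where open ≡-Reasoning

Σ-suc : ∀ {k} (f : Fin k → ℕ) → Σ[ k ] (λ x → suc (f x)) ≡ Σ[ k ] f + k
Σ-suc {k} f = trans (Σ-distrib-+ (λ _ → 1) f) $ begin
  Σ[ k ] (λ _ → 1) + Σ[ k ] f ≡⟨ cong (_+ Σ[ k ] f) (trans (Σ-const k 1) (*-identityʳ k)) ⟩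
  k + Σ[ k ] f                ≡⟨ +-comm k _ ⟩
  Σ[ k ] f + k                ∎
  where open ≡-Reasoning

Σ-∸1 : ∀ {k} (f : Fin k → ℕ) → (∀ x → 1 ≤ f x) → Σ[ k ] (λ x → f x ∸ 1) + k ≡ Σ[ k ] f
Σ-∸1 f 1≤f = trans (sym (Σ-suc (λ x → f x ∸ 1))) (Σ-cong λ x → trans (+-comm 1 (f x ∸ 1)) (m∸n+n≡m (1≤f x)))

f≤Σ : ∀ {k} (f : Fin k → ℕ) x → f x ≤ Σ[ k ] f
f≤Σ f zero    = m≤m+n _ _
f≤Σ f (suc x) = ≤-trans (f≤Σ (f ∘ suc) x) (m≤n+m _ (f zero))

𝟙 : Bool → ℕ
𝟙 c = if c then 1 else 0

∣p∣≡Σ𝟙 : ∀ {n} (p : Subset n) → ∣ p ∣ ≡ Σ[ n ] (λ v → 𝟙 (lookup p v))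
∣p∣≡Σ𝟙 []            = refl
∣p∣≡Σ𝟙 (inside  ∷ p) = cong suc (∣p∣≡Σ𝟙 p)
∣p∣≡Σ𝟙 (outside ∷ p) = ∣p∣≡Σ𝟙 p

Σ-blockIndex : ∀ {n b} (Bs : Fin b → Subset n) → Σ[ n ] (blockIndex Bs) ≡ Σ[ b ] (λ i → ∣ Bs i ∣)
Σ-blockIndex Bs = trans (Σ-comm (λ v i → 𝟙 (lookup (Bs i) v))) (sym (Σ-cong (∣p∣≡Σ𝟙 ∘ Bs)))

1≤blockIndex : ∀ {n b} (Bs : Fin b → Subset n) {v i} → v ∈ Bs i → 1 ≤ blockIndex Bs v
1≤blockIndex Bs {v} {i} v∈ =
  ≤-trans (≤-reflexive (sym (cong 𝟙 ([]=⇒lookup v∈)))) (f≤Σ (λ j → 𝟙 (lookup (Bs j) v)) i)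

x∈p─q⇒x∉q : ∀ {n} {x : Fin n} {p q : Subset n} → x ∈ p ─ q → x ∉ q
x∈p─q⇒x∉q {p = _ ∷ p} {inside  ∷ q} (there x∈) (there x∈q) = x∈p─q⇒x∉q x∈ x∈q
x∈p─q⇒x∉q {p = _ ∷ p} {outside ∷ q} (there x∈) (there x∈q) = x∈p─q⇒x∉q x∈ x∈q
x∈p─q⇒x∉q {p = inside ∷ p} {outside ∷ q} here ()

x∈p-y⇒x∈p : ∀ {n} {x y : Fin n} {p : Subset n} → x ∈ p - y → x ∈ p
x∈p-y⇒x∈p {y = y} {p} = p─q⊆p p ⁅ y ⁆

x∈p-y⇒x≢y : ∀ {n} {x y : Fin n} {p : Subset n} → x ∈ p - y → x ≢ y
x∈p-y⇒x≢y {y = y} x∈ refl = x∈p─q⇒x∉q x∈ (x∈⁅x⁆ y)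

∣p∣≤1+∣p-x∣ : ∀ {n} (p : Subset n) x → ∣ p ∣ ≤ suc ∣ p - x ∣
∣p∣≤1+∣p-x∣ (inside  ∷ p) zero    = s≤s (≤-reflexive (sym (cong ∣_∣ (p─⊥≡p p))))
∣p∣≤1+∣p-x∣ (outside ∷ p) zero    = ≤-trans (≤-reflexive (sym (cong ∣_∣ (p─⊥≡p p)))) (n≤1+n _)
∣p∣≤1+∣p-x∣ (inside  ∷ p) (suc x) = s≤s (∣p∣≤1+∣p-x∣ p x)
∣p∣≤1+∣p-x∣ (outside ∷ p) (suc x) = ∣p∣≤1+∣p-x∣ p x

p⊆q⇒p-x⊆q-x : ∀ {n} {p q : Subset n} {x} → p ⊆ q → p - x ⊆ q - x
p⊆q⇒p-x⊆q-x p⊆q y∈ = x∈p∧x≢y⇒x∈p-y (p⊆q (x∈p-y⇒x∈p y∈)) (x∈p-y⇒x≢y y∈)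

x∈p∪q-y⁻ : ∀ {n} (p q : Subset n) {x y} → x ∈ p ∪ q - y → x ∈ p - y ⊎ x ∈ q - y
x∈p∪q-y⁻ p q x∈ = Sum.map (λ x∈p → x∈p∧x≢y⇒x∈p-y x∈p (x∈p-y⇒x≢y x∈)) (λ x∈q → x∈p∧x≢y⇒x∈p-y x∈q (x∈p-y⇒x≢y x∈))
  (x∈p∪q⁻ p q (x∈p-y⇒x∈p x∈))

suc≤∣p∣⇒≤∣p-x∣ : ∀ {n k} (p : Subset n) x → suc k ≤ ∣ p ∣ → k ≤ ∣ p - x ∣
suc≤∣p∣⇒≤∣p-x∣ p x k<∣p∣ = ≤-pred (≤-trans k<∣p∣ (∣p∣≤1+∣p-x∣ p x))

nonempty : ∀ {n} (p : Subset n) → 1 ≤ ∣ p ∣ → Nonempty p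
nonempty (inside  ∷ p) _ = zero , here
nonempty (outside ∷ p) 1≤∣p∣ = let x , x∈p = nonempty p 1≤∣p∣ in suc x , there x∈p

injective⇒∣p∣≤ : ∀ {n b} {p : Subset n} (f : ∀ {x} → x ∈ p → Fin b) →
  (∀ {x y} (x∈p : x ∈ p) (y∈p : y ∈ p) → f x∈p ≡ f y∈p → x ≡ y) → ∣ p ∣ ≤ b
injective⇒∣p∣≤ {p = []} f inj = z≤n
injective⇒∣p∣≤ {p = outside ∷ p} f inj =
  injective⇒∣p∣≤ (f ∘ there) (λ x∈p y∈p eq → Fin.suc-injective (inj (there x∈p) (there y∈p) eq))
injective⇒∣p∣≤ {b = zero} {p = inside ∷ p} f inj with () ← f here
injective⇒∣p∣≤ {b = suc b} {p = inside ∷ p} f inj =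
  s≤s (injective⇒∣p∣≤ g (λ x∈p y∈p eq →
    Fin.suc-injective (inj (there x∈p) (there y∈p) (punchOut-injective (f₀≢ x∈p) (f₀≢ y∈p) eq))))
  where
  f₀≢ : ∀ {x} (x∈p : x ∈ p) → f here ≢ f (there x∈p)
  f₀≢ x∈p eq with () ← inj here (there x∈p) eq
  g : ∀ {x} → x ∈ p → Fin b
  g x∈p = punchOut (f₀≢ x∈p)

injective⇒≤∣p∣ : ∀ {n b} {p : Subset n} (t : Fin b → Fin n) → (∀ {i j} → t i ≡ t j → i ≡ j) →
  (∀ i → t i ∈ p) → b ≤ ∣ p ∣
injective⇒≤∣p∣ {b = zero} t inj t∈p = z≤n
injective⇒≤∣p∣ {b = suc b} {p} t inj t∈p = ≤-trans
  (s≤s (injective⇒≤∣p∣ {p = p - t zero} (t ∘ suc) (Fin.suc-injective ∘ inj)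
    (λ i → x∈p∧x≢y⇒x∈p-y (t∈p (suc i)) (λ eq → case inj {suc i} {zero} eq of λ ()))))
  (x∈p⇒∣p-x∣<∣p∣ (t∈p zero))

fromList : ∀ {n} → List (Fin n) → Subset n
fromList []       = ⊥
fromList (x ∷ xs) = ⁅ x ⁆ ∪ fromList xs

∈-fromList⁺ : ∀ {n} {x : Fin n} xs → x ∈ˡ xs → x ∈ fromList xs
∈-fromList⁺ (x ∷ _)  (here refl) = x∈p∪q⁺ (inj₁ (x∈⁅x⁆ x))
∈-fromList⁺ (_ ∷ xs) (there x∈)  = x∈p∪q⁺ (inj₂ (∈-fromList⁺ xs x∈))

∈-fromList⁻ : ∀ {n} {x : Fin n} xs → x ∈ fromList xs → x ∈ˡ xs
∈-fromList⁻ []       x∈ = ⊥-elim (∉⊥ x∈)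
∈-fromList⁻ (y ∷ xs) x∈ with x∈p∪q⁻ ⁅ y ⁆ (fromList xs) x∈
... | inj₁ x∈⁅y⁆ = here (x∈⁅y⁆⇒x≡y y x∈⁅y⁆)
... | inj₂ x∈xs  = there (∈-fromList⁻ xs x∈xs)

fin-or-zero : ∀ k → Fin k ⊎ k ≡ 0
fin-or-zero zero    = inj₂ refl
fin-or-zero (suc k) = inj₁ zero

least : ∀ {P : ℕ → Set} → Decidable P → ∀ {k} → P k → ∃ λ m → P m × (∀ {j} → j < m → ¬ P j)
least P? {zero} Pk = 0 , Pk , λ ()
least {P} P? {suc k} Pk with P? 0
... | yes P0 = 0 , P0 , λ ()
... | no ¬P0 with m , Pm , below ← least {P ∘ suc} (P? ∘ suc) {k} Pk =
  suc m , Pm , λ { {zero} _ → ¬P0 ; {suc j} j<m → below (≤-pred j<m) }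

argmin : ∀ {n} (f : Fin n → ℕ) {p : Subset n} → Nonempty p → ∃ λ a → a ∈ p × (∀ {x} → x ∈ p → f a ≤ f x)
argmin f {p} (x , x∈p)
  with _ , (a , a∈p , refl) , below ← least (λ k → any? (λ y → (y ∈? p) ×-dec (f y ≟ k))) (x , x∈p , refl) =
  a , a∈p , λ {y} y∈p → ≮⇒≥ λ fy<fa → below fy<fa (y , y∈p , refl)

uniform-bound : ∀ {m} {P : Fin m → Set} (Q : ℕ → Fin m → Set) →
  (∀ {k k' w} → k ≤ k' → Q k w → Q k' w) → Decidable P →
  (∀ w → P w → ∃ λ k → Q k w) → ∃ λ K → ∀ w → P w → Q K w
uniform-bound {zero} Q mono P? bound = 0 , λ ()
uniform-bound {suc m} Q mono P? bound
  with K , QK ← uniform-bound (λ k → Q k ∘ suc) mono (P? ∘ suc) (bound ∘ suc) | P? zero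
... | no ¬P0 = K , λ { zero P0 → ⊥-elim (¬P0 P0) ; (suc w) → QK w }
... | yes P0 with k₀ , Qk₀ ← bound zero P0 =
  k₀ + K , λ { zero _ → mono (m≤m+n k₀ K) Qk₀ ; (suc w) Pw → mono (m≤n+m K k₀) (QK w Pw) }

-- Walks and nonseparable sets

module _ {n : ℕ} (G : Graph n) where

  Walk : Subset n → Fin n → Fin n → Set
  Walk W = Star (AdjIn G W)

  vertices : ∀ {W x y} → Walk W x y → List (Fin n)
  vertices {x = x} ε       = x ∷ []
  vertices {x = x} (_ ◅ p) = x ∷ vertices p

  start∈vertices : ∀ {W x y} (p : Walk W x y) → x ∈ˡ vertices p
  start∈vertices ε       = here refl
  start∈vertices (_ ◅ p) = here refl

  end∈vertices : ∀ {W x y} (p : Walk W x y) → y ∈ˡ vertices p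
  end∈vertices ε       = here refl
  end∈vertices (_ ◅ p) = there (end∈vertices p)

  vertices⊆ : ∀ {W x y z} → x ∈ W → (p : Walk W x y) → z ∈ˡ vertices p → z ∈ W
  vertices⊆ x∈W ε                 (here refl) = x∈W
  vertices⊆ x∈W (_ ◅ p)           (here refl) = x∈W
  vertices⊆ x∈W ((_ , y∈W , _) ◅ p) (there z∈) = vertices⊆ y∈W p z∈

  symAdjIn : ∀ {W x y} → AdjIn G W x y → AdjIn G W y x
  symAdjIn (x∈W , y∈W , xy) = y∈W , x∈W , symAdj G xy

  walk-to-end : ∀ {W W' x y c} (p : Walk W x y) → (∀ {z} → z ∈ˡ vertices p → z ∈ W') →
    c ∈ˡ vertices p → Walk W' c y
  walk-to-end ε        inW' (here refl) = ε
  walk-to-end ((_ , _ , xy) ◅ p) inW' (here refl) =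
    (inW' (here refl) , inW' (there (start∈vertices p)) , xy) ◅ walk-to-end p (inW' ∘ there) (start∈vertices p)
  walk-to-end (_ ◅ p) inW' (there c∈) = walk-to-end p (inW' ∘ there) c∈

  walk-to-start : ∀ {W W' x y c} (p : Walk W x y) → (∀ {z} → z ∈ˡ vertices p → z ∈ W') →
    c ∈ˡ vertices p → Walk W' c x
  walk-to-start ε       inW' (here refl) = ε
  walk-to-start (_ ◅ p) inW' (here refl) = ε
  walk-to-start ((_ , _ , xy) ◅ p) inW' (there c∈) =
    walk-to-start p (inW' ∘ there) c∈ ◅◅ ((inW' (there (start∈vertices p)) , inW' (here refl) , symAdj G xy) ◅ ε)

  walk-to-an-end-avoiding : ∀ {W W' x y u c} (p : Walk W x y) → Unique (vertices p) →
    (∀ {z} → z ∈ˡ vertices p → z ≢ u → z ∈ W') → c ∈ˡ vertices p → c ≢ u →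
    Walk W' c x ⊎ Walk W' c y
  walk-to-an-end-avoiding ε       _ _ (here refl) _ = inj₁ ε
  walk-to-an-end-avoiding (_ ◅ p) _ _ (here refl) _ = inj₁ ε
  walk-to-an-end-avoiding {x = x} {u = u} ((_ , _ , xy) ◅ p) (x≢ ∷ simple) inW' (there c∈) c≢u with x Fin.≟ u
  ... | yes refl = inj₂ (walk-to-end p (λ z∈ → inW' (there z∈) (λ { refl → All.lookup x≢ z∈ refl })) c∈)
  ... | no x≢u with walk-to-an-end-avoiding p simple (inW' ∘ there) c∈ c≢u
  ...   | inj₂ c→y  = inj₂ c→y
  ...   | inj₁ c→x' = inj₁ (c→x' ◅◅ ((vertices⊆ (inW' (there c∈) c≢u) c→x' (end∈vertices c→x') ,
                                     inW' (here refl) x≢u , symAdj G xy) ◅ ε))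

  suffix : ∀ {W x y z} (p : Walk W y z) → x ∈ˡ vertices p →
    Σ (Walk W x z) λ q → (∀ {w} → w ∈ˡ vertices q → w ∈ˡ vertices p) × (Unique (vertices p) → Unique (vertices q))
  suffix ε       (here refl) = ε , id , id
  suffix (e ◅ p) (here refl) = e ◅ p , id , id
  suffix (e ◅ p) (there x∈)  with q , q⊆ , uq ← suffix p x∈ = q , there ∘ q⊆ , λ { (_ ∷ u) → uq u }

  simplify : ∀ {W x y} (p : Walk W x y) →
    Σ (Walk W x y) λ q → Unique (vertices q) × (∀ {w} → w ∈ˡ vertices q → w ∈ˡ vertices p)
  simplify ε = ε , All.[] ∷ [] , id
  simplify {x = x} (e ◅ p) with simplify p
  ... | q , uq , q⊆ with Any.any? (x Fin.≟_) (vertices q)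
  ...   | yes x∈q = let q' , q'⊆ , uq' = suffix q x∈q in q' , uq' uq , there ∘ q⊆ ∘ q'⊆
  ...   | no x∉q = e ◅ q , ¬Any⇒All¬ _ x∉q ∷ uq , λ { (here refl) → here refl ; (there w∈) → there (q⊆ w∈) }

  connected-via : ∀ {W} h → (∀ {c} → c ∈ W → Walk W c h) → Connected G W
  connected-via h to-h u v u∈W v∈W = to-h u∈W ◅◅ reverse symAdjIn (to-h v∈W)

  complete⇒connected : ∀ {W} → Complete G W → Connected G W
  complete⇒connected complete u v u∈W v∈W with u Fin.≟ v
  ... | yes refl = ε
  ... | no u≢v   = (u∈W , v∈W , complete u v u∈W v∈W u≢v) ◅ ε

  complete⇒nonseparable : ∀ {W} → Complete G W → Nonseparable G W
  complete⇒nonseparable complete = complete⇒connected complete , λ x _ →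
    complete⇒connected (λ u v u∈ v∈ → complete u v (x∈p-y⇒x∈p u∈) (x∈p-y⇒x∈p v∈))

  fromList-complete : ∀ {xs} → AllPairs (Adj G) xs → Complete G (fromList xs)
  fromList-complete {xs} adjacent x y x∈ y∈ = pairwise adjacent (∈-fromList⁻ xs x∈) (∈-fromList⁻ xs y∈)
    where
    pairwise : ∀ {x y ys} → AllPairs (Adj G) ys → x ∈ˡ ys → y ∈ˡ ys → x ≢ y → Adj G x y
    pairwise (_ ∷ _)    (here refl) (here refl) x≢y = ⊥-elim (x≢y refl)
    pairwise (adjs ∷ _) (here refl) (there y∈)  _   = All.lookup adjs y∈
    pairwise (adjs ∷ _) (there x∈)  (here refl) _   = symAdj G (All.lookup adjs x∈)
    pairwise (_ ∷ rest) (there x∈)  (there y∈)  x≢y = pairwise rest x∈ y∈ x≢y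

  cycle-nonseparable : ∀ {W a b v} (p : Walk W a b) → Unique (vertices p) → v ∉ˡ vertices p →
    Adj G v a → Adj G v b → Nonseparable G (fromList (v ∷ vertices p))
  cycle-nonseparable {a = a} {b} {v} p simple v∉p va vb =
    connected-via v to-v-in-C , connected-minus
    where
    C : Subset n
    C = fromList (v ∷ vertices p)
    v∈C : v ∈ C
    v∈C = ∈-fromList⁺ (v ∷ vertices p) (here refl)
    p⊆C : ∀ {z} → z ∈ˡ vertices p → z ∈ C
    p⊆C z∈ = ∈-fromList⁺ (v ∷ vertices p) (there z∈)
    on-p : ∀ {c} → c ∈ C → c ≢ v → c ∈ˡ vertices p
    on-p c∈ c≢v with ∈-fromList⁻ (v ∷ vertices p) c∈
    ... | here refl = ⊥-elim (c≢v refl)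
    ... | there c∈p = c∈p
    to-v : ∀ {W' c} → c ∈ W' → v ∈ W' → Walk W' c a ⊎ Walk W' c b → Walk W' c v
    to-v c∈W' v∈W' (inj₁ c→a) = c→a ◅◅ ((vertices⊆ c∈W' c→a (end∈vertices c→a) , v∈W' , symAdj G va) ◅ ε)
    to-v c∈W' v∈W' (inj₂ c→b) = c→b ◅◅ ((vertices⊆ c∈W' c→b (end∈vertices c→b) , v∈W' , symAdj G vb) ◅ ε)
    to-v-in-C : ∀ {c} → c ∈ C → Walk C c v
    to-v-in-C {c} c∈ with c Fin.≟ v
    ... | yes refl = ε
    ... | no c≢v   = to-v c∈ v∈C (inj₁ (walk-to-start p p⊆C (on-p c∈ c≢v)))
    connected-minus : ∀ u → u ∈ C → Connected G (C - u)
    connected-minus u _ with u Fin.≟ v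
    ... | yes refl = connected-via a λ c∈ →
          walk-to-start p p⊆C-v (on-p (x∈p-y⇒x∈p c∈) (x∈p-y⇒x≢y c∈))
      where
      p⊆C-v : ∀ {z} → z ∈ˡ vertices p → z ∈ C - v
      p⊆C-v z∈ = x∈p∧x≢y⇒x∈p-y (p⊆C z∈) λ { refl → v∉p z∈ }
    ... | no u≢v = connected-via v λ {c} c∈ → case c Fin.≟ v of λ where
      (yes refl) → ε
      (no c≢v)   → to-v c∈ (x∈p∧x≢y⇒x∈p-y v∈C (u≢v ∘ sym))
        (walk-to-an-end-avoiding p simple (x∈p∧x≢y⇒x∈p-y ∘ p⊆C) (on-p (x∈p-y⇒x∈p c∈) c≢v) (x∈p-y⇒x≢y c∈))

  restrict : ∀ {W W' x y} → W ⊆ W' → Walk W x y → Walk W' x y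
  restrict W⊆W' = gmap id λ (x∈ , y∈ , xy) → W⊆W' x∈ , W⊆W' y∈ , xy

  connected-∪ : ∀ {W₁ W₂ W c} → Connected G W₁ → Connected G W₂ → W₁ ⊆ W → W₂ ⊆ W →
    (∀ {x} → x ∈ W → x ∈ W₁ ⊎ x ∈ W₂) → c ∈ W₁ → c ∈ W₂ → Connected G W
  connected-∪ {W = W} {c} conn₁ conn₂ W₁⊆W W₂⊆W split c∈₁ c∈₂ = connected-via c to-c
    where
    to-c : ∀ {x} → x ∈ W → Walk W x c
    to-c x∈ with split x∈
    ... | inj₁ x∈₁ = restrict W₁⊆W (conn₁ _ _ x∈₁ c∈₁)
    ... | inj₂ x∈₂ = restrict W₂⊆W (conn₂ _ _ x∈₂ c∈₂)

  nonseparable-minus : ∀ {W} → Nonseparable G W → ∀ u → Connected G (W - u)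
  nonseparable-minus {W} (conn , conn-minus) u with u ∈? W
  ... | yes u∈W = conn-minus u u∈W
  ... | no u∉W  = λ x y x∈ y∈ → restrict W⊆W-u (conn x y (x∈p-y⇒x∈p x∈) (x∈p-y⇒x∈p y∈))
    where
    W⊆W-u : W ⊆ W - u
    W⊆W-u z∈ = x∈p∧x≢y⇒x∈p-y z∈ λ { refl → u∉W z∈ }

  nonseparable-∪ : ∀ {W₁ W₂ x y} → Nonseparable G W₁ → Nonseparable G W₂ → x ≢ y →
    x ∈ W₁ → y ∈ W₁ → x ∈ W₂ → y ∈ W₂ → Nonseparable G (W₁ ∪ W₂)
  nonseparable-∪ {W₁} {W₂} {x} {y} ns₁ ns₂ x≢y x∈₁ y∈₁ x∈₂ y∈₂ =
    connected-∪ (proj₁ ns₁) (proj₁ ns₂) (p⊆p∪q W₂) (q⊆p∪q W₁ W₂) (x∈p∪q⁻ W₁ W₂) x∈₁ x∈₂ ,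
    λ u _ → connected-minus u
    where
    via : ∀ {u c} → c ≢ u → c ∈ W₁ → c ∈ W₂ → Connected G (W₁ ∪ W₂ - u)
    via {u} c≢u c∈₁ c∈₂ = connected-∪ (nonseparable-minus ns₁ u) (nonseparable-minus ns₂ u)
      (p⊆q⇒p-x⊆q-x (p⊆p∪q W₂)) (p⊆q⇒p-x⊆q-x (q⊆p∪q W₁ W₂)) (x∈p∪q-y⁻ W₁ W₂)
      (x∈p∧x≢y⇒x∈p-y c∈₁ c≢u) (x∈p∧x≢y⇒x∈p-y c∈₂ c≢u)
    connected-minus : ∀ u → Connected G (W₁ ∪ W₂ - u)
    connected-minus u with x Fin.≟ u
    ... | yes refl = via (x≢y ∘ sym) y∈₁ y∈₂
    ... | no x≢u   = via x≢u x∈₁ x∈₂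

  block-maximal : ∀ {W W'} → IsBlock G W → W ⊆ W' → Nonseparable G W' → W' ⊆ W
  block-maximal {W} {W'} (_ , maximal) W⊆W' ns' {x} x∈W' with x ∈? W
  ... | yes x∈W = x∈W
  ... | no x∉W  = ⊥-elim (maximal W' (W⊆W' , x , x∈W' , x∉W) ns')

  block-nonempty : ∀ {W} → Fin n → IsBlock G W → Nonempty W
  block-nonempty {W} r (_ , maximal) with nonempty? W
  ... | yes nonempty-W = nonempty-W
  ... | no empty-W = ⊥-elim (maximal (fromList (r ∷ []))
        ((λ {x} x∈W → ⊥-elim (empty-W (x , x∈W))) , r , ∈-fromList⁺ (r ∷ []) (here refl) , λ r∈W → empty-W (r , r∈W))
        (complete⇒nonseparable (fromList-complete (All.[] ∷ []))))

  blocks-sharing-two-vertices-coincide : ∀ {W₁ W₂ x y} → IsBlock G W₁ → IsBlock G W₂ → x ≢ y →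
    x ∈ W₁ → y ∈ W₁ → x ∈ W₂ → y ∈ W₂ → W₁ ≡ W₂
  blocks-sharing-two-vertices-coincide {W₁} {W₂} block₁ block₂ x≢y x∈₁ y∈₁ x∈₂ y∈₂ =
    ⊆-antisym (⊆-trans (p⊆p∪q W₂) W₁∪W₂⊆W₂) (⊆-trans (q⊆p∪q W₁ W₂) W₁∪W₂⊆W₁)
    where
    ns : Nonseparable G (W₁ ∪ W₂)
    ns = nonseparable-∪ (proj₁ block₁) (proj₁ block₂) x≢y x∈₁ y∈₁ x∈₂ y∈₂
    W₁∪W₂⊆W₁ : W₁ ∪ W₂ ⊆ W₁
    W₁∪W₂⊆W₁ = block-maximal block₁ (p⊆p∪q W₂) ns
    W₁∪W₂⊆W₂ : W₁ ∪ W₂ ⊆ W₂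
    W₁∪W₂⊆W₂ = block-maximal block₂ (q⊆p∪q W₁ W₂) ns

module _ {n b : ℕ} (G : Graph n) {Bs : Fin b → Subset n} (blocks : BlocksOf G Bs) where

  nonseparable⊆block : ∀ {W} → Nonseparable G W → ∃ λ i → W ⊆ Bs i
  nonseparable⊆block {W} = go W (<-wellFounded (n ∸ ∣ W ∣))
    where
    go : ∀ W → Acc _<_ (n ∸ ∣ W ∣) → Nonseparable G W → ∃ λ i → W ⊆ Bs i
    go W (acc smaller) ns with any? (λ i → W ⊆? Bs i)
    ... | yes W⊆block = W⊆block
    ... | no W⊈blocks =
      let i , Bsᵢ≡W = proj₂ (proj₂ blocks) W (ns , maximal) in ⊥-elim (W⊈blocks (i , ⊆-reflexive (sym Bsᵢ≡W)))
      where
      maximal : ∀ W' → W ⊂ W' → ¬ Nonseparable G W'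
      maximal W' W⊂W' ns' with i , W'⊆Bsᵢ ← go W' (smaller (∸-monoʳ-< (p⊂q⇒∣p∣<∣q∣ W⊂W') (∣p∣≤n W'))) ns' =
        W⊈blocks (i , ⊆-trans (proj₁ W⊂W') W'⊆Bsᵢ)

-- Zero forcing in a clique

module _ {n : ℕ} (G : Graph n) where

  clique-forcing : ∀ {W S v} → Complete G W → Blue G W S v → v ∈ S ⊎ ∃ λ x → W - x ⊆ S
  clique-forcing complete (initial v∈S) = inj₁ v∈S
  clique-forcing {W} {S} {v} complete (force {u} blue-u (u∈W , _ , _) blue-rest)
    with clique-forcing complete blue-u
  ... | inj₂ W-x⊆S = inj₂ W-x⊆S
  ... | inj₁ u∈S with any? (λ w → (w ∈? W - v) ×-dec ¬? (w ∈? S))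
  ...   | no none = inj₂ (v , λ {w} w∈ → decidable-stable (w ∈? S) (λ w∉S → none (w , w∈ , w∉S)))
  ...   | yes (w , w∈W-v , w∉S) = Sum.[ ⊥-elim ∘ w∉S , inj₂ ]′
    (clique-forcing complete (blue-rest w (u∈W , w∈W , complete u w u∈W w∈W u≢w) (x∈p-y⇒x≢y w∈W-v)))
    where
    w∈W : w ∈ W
    w∈W = x∈p-y⇒x∈p w∈W-v
    u≢w : u ≢ w
    u≢w refl = w∉S u∈S

  clique-minus-vertex-is-zfs : ∀ {W x u} → Complete G W → x ∈ W → u ∈ W - x → IsZFS G W (W - x)
  clique-minus-vertex-is-zfs {W} {x} {u} complete x∈W u∈W-x = x∈p-y⇒x∈p , blue
    where
    blue : ∀ v → v ∈ W → Blue G W (W - x) v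
    blue v v∈W with v Fin.≟ x
    ... | no v≢x   = initial (x∈p∧x≢y⇒x∈p-y v∈W v≢x)
    ... | yes refl = force (initial u∈W-x)
      (x∈p-y⇒x∈p u∈W-x , x∈W , complete u x (x∈p-y⇒x∈p u∈W-x) x∈W (x∈p-y⇒x≢y u∈W-x))
      (λ w (_ , w∈W , _) w≢x → initial (x∈p∧x≢y⇒x∈p-y w∈W w≢x))

  ∣clique∣≤1+∣zfs∣ : ∀ {W S} → Complete G W → IsZFS G W S → ∣ W ∣ ≤ suc ∣ S ∣
  ∣clique∣≤1+∣zfs∣ {W} {S} complete (_ , blue) with any? (λ v → (v ∈? W) ×-dec ¬? (v ∈? S))
  ... | no none = ≤-trans (p⊆q⇒∣p∣≤∣q∣ λ {v} v∈W → decidable-stable (v ∈? S) (λ v∉S → none (v , v∈W , v∉S)))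
                         (n≤1+n ∣ S ∣)
  ... | yes (v , v∈W , v∉S) with clique-forcing complete (blue v v∈W)
  ...   | inj₁ v∈S = ⊥-elim (v∉S v∈S)
  ...   | inj₂ (y , W-y⊆S) = ≤-trans (∣p∣≤1+∣p-x∣ W y) (s≤s (p⊆q⇒∣p∣≤∣q∣ W-y⊆S))

  Z-complete : ∀ {W k} → Complete G W → 2 ≤ ∣ W ∣ → IsZ G W k → suc k ≡ ∣ W ∣
  Z-complete {W} complete 2≤∣W∣ ((S , zfs , refl) , minimal)
    with x , x∈W ← nonempty W (≤-trans (s≤s z≤n) 2≤∣W∣)
    with _ , u∈W-x ← nonempty (W - x) (suc≤∣p∣⇒≤∣p-x∣ W x 2≤∣W∣) = ≤-antisym
    (≤-trans (s≤s (minimal (W - x) (clique-minus-vertex-is-zfs complete x∈W u∈W-x))) (x∈p⇒∣p-x∣<∣p∣ x∈W))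
    (∣clique∣≤1+∣zfs∣ complete zfs)

-- Zero forcing in a graph covered by cliques

-- Blue records no times: BlueBy k v says that v is blue after k rounds of simultaneous forcing.
module Rounds {n : ℕ} (G : Graph n) (adj? : ∀ u v → Dec (Adj G u v)) (S : Subset n) where

  BlueBy : ℕ → Fin n → Set
  ForcesAt : ℕ → Fin n → Fin n → Set

  BlueBy zero    v = v ∈ S
  BlueBy (suc k) v = BlueBy k v ⊎ ∃ λ u → ForcesAt k u v

  ForcesAt k u v = BlueBy k u × Adj G u v × (∀ w → Adj G u w → w ≢ v → BlueBy k w)

  blueBy? : ∀ k v → Dec (BlueBy k v)
  forcesAt? : ∀ k u v → Dec (ForcesAt k u v)

  blueBy? zero    v = v ∈? S
  blueBy? (suc k) v = blueBy? k v ⊎-dec any? (λ u → forcesAt? k u v)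

  forcesAt? k u v = blueBy? k u ×-dec adj? u v ×-dec
    all? (λ w → adj? u w →-dec ¬? (w Fin.≟ v) →-dec blueBy? k w)

  blueBy-mono : ∀ {k k' v} → k ≤ k' → BlueBy k v → BlueBy k' v
  blueBy-mono = go ∘ ≤⇒≤′
    where
    go : ∀ {k k' v} → k ≤′ k' → BlueBy k v → BlueBy k' v
    go ≤′-refl        blue = blue
    go (≤′-step k≤k') blue = inj₁ (go k≤k' blue)

  blue⇒blueBy : ∀ {v} → Blue G ⊤ S v → ∃ λ k → BlueBy k v
  blue⇒blueBy (initial v∈S) = 0 , v∈S
  blue⇒blueBy {v} (force {u} blue-u (_ , _ , uv) blue-rest)
    with k , u-by-k ← blue⇒blueBy blue-u
    with K , rest-by-K ← uniform-bound BlueBy blueBy-mono (λ w → adj? u w ×-dec ¬? (w Fin.≟ v))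
                           (λ w (uw , w≢v) → blue⇒blueBy (blue-rest w (∈⊤ , ∈⊤ , uw) w≢v)) =
    suc (k + K) , inj₂ (u , blueBy-mono (m≤m+n k K) u-by-k , uv ,
                        λ w uw w≢v → blueBy-mono (m≤n+m K k) (rest-by-K w (uw , w≢v)))

  first-forcing : ∀ {k v} → v ∉ S → BlueBy k v → ∃₂ λ j u → ¬ BlueBy j v × ForcesAt j u v
  first-forcing {zero}  v∉S v∈S = ⊥-elim (v∉S v∈S)
  first-forcing {suc k} v∉S (inj₁ v-by-k) = first-forcing v∉S v-by-k
  first-forcing {suc k} {v} v∉S (inj₂ (u , u-forces)) with blueBy? k v
  ... | yes v-by-k = first-forcing v∉S v-by-k
  ... | no ¬v-by-k = k , u , ¬v-by-k , u-forces

module CliqueCover {n b : ℕ} (G : Graph n) (Bs : Fin b → Subset n) (complete : ∀ i → Complete G (Bs i))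
                   (cover : ∀ {u v} → Adj G u v → ∃ λ i → u ∈ Bs i × v ∈ Bs i) where

  adj? : ∀ u v → Dec (Adj G u v)
  adj? u v with u Fin.≟ v
  ... | yes refl = no (irrAdj G)
  ... | no u≢v with any? (λ i → (u ∈? Bs i) ×-dec (v ∈? Bs i))
  ...   | yes (i , u∈ , v∈) = yes (complete i u v u∈ v∈ u≢v)
  ...   | no none = no (none ∘ cover)

  zfs-lower-bound : ∀ {S} → IsZFS G ⊤ S → n ≤ ∣ S ∣ + b
  zfs-lower-bound {S} (_ , blue) = ≤-trans (m≤n+m∸n n ∣ S ∣)
    (+-monoʳ-≤ ∣ S ∣ (subst (_≤ b) (∣∁p∣≡n∸∣p∣ S) (injective⇒∣p∣≤ forcing-clique forcing-clique-injective)))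
    where
    open Rounds G adj? S

    FirstForcingInClique : Fin n → Fin b → Set
    FirstForcingInClique v i = ∃₂ λ j u → ¬ BlueBy j v × ForcesAt j u v × u ∈ Bs i × v ∈ Bs i

    first-forcing-clique : ∀ {v} → v ∈ ∁ S → ∃ (FirstForcingInClique v)
    first-forcing-clique {v} v∈∁S
      with j , u , ¬v-by-j , u-forces ← first-forcing (x∈∁p⇒x∉p v∈∁S) (proj₂ (blue⇒blueBy (blue v ∈⊤)))
      with i , u∈ , v∈ ← cover (proj₁ (proj₂ u-forces)) = i , j , u , ¬v-by-j , u-forces , u∈ , v∈

    forcing-clique : ∀ {v} → v ∈ ∁ S → Fin b
    forcing-clique = proj₁ ∘ first-forcing-clique

    later-forced-outside : ∀ {i j j' u v v'} → j ≤ j' → ForcesAt j u v → ¬ BlueBy j' v' →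
      u ∈ Bs i → v' ∈ Bs i → v' ≡ v
    later-forced-outside {i} {u = u} {v} {v'} j≤j' (u-by-j , _ , rest-by-j) ¬v'-by-j' u∈ v'∈
      with v' Fin.≟ v | v' Fin.≟ u
    ... | yes v'≡v | _        = v'≡v
    ... | no _     | yes refl = ⊥-elim (¬v'-by-j' (blueBy-mono j≤j' u-by-j))
    ... | no v'≢v  | no v'≢u  =
      ⊥-elim (¬v'-by-j' (blueBy-mono j≤j' (rest-by-j v' (complete i u v' u∈ v'∈ (v'≢u ∘ sym)) v'≢v)))

    one-first-forcing-per-clique : ∀ {v v' i} → FirstForcingInClique v i → FirstForcingInClique v' i → v ≡ v'
    one-first-forcing-per-clique (j , _ , ¬v-by-j , u-forces , u∈ , v∈) (j' , _ , ¬v'-by-j' , u'-forces , u'∈ , v'∈)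
      with ≤-total j j'
    ... | inj₁ j≤j' = sym (later-forced-outside j≤j' u-forces ¬v'-by-j' u∈ v'∈)
    ... | inj₂ j'≤j = later-forced-outside j'≤j u'-forces ¬v-by-j u'∈ v∈

    forcing-clique-injective : ∀ {v v'} (v∈ : v ∈ ∁ S) (v'∈ : v' ∈ ∁ S) →
      forcing-clique v∈ ≡ forcing-clique v'∈ → v ≡ v'
    forcing-clique-injective v∈ v'∈ same = one-first-forcing-per-clique (proj₂ (first-forcing-clique v∈))
      (subst (FirstForcingInClique _) (sym same) (proj₂ (first-forcing-clique v'∈)))

-- Clique trees

module CliqueTree {n b : ℕ} (G : Graph n) (Bs : Fin b → Subset n)
                  (cliqueTree : IsCliqueTree G) (blocks : BlocksOf G Bs) where

  block-complete : ∀ i → Complete G (Bs i)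
  block-complete i = proj₂ cliqueTree (Bs i) (proj₁ blocks i)

  clique⊆block : ∀ {xs} → AllPairs (Adj G) xs → ∃ λ i → ∀ {x} → x ∈ˡ xs → x ∈ Bs i
  clique⊆block {xs} adjacent =
    let i , ⊆Bsᵢ = nonseparable⊆block G blocks (complete⇒nonseparable G (fromList-complete G adjacent))
    in i , ⊆Bsᵢ ∘ ∈-fromList⁺ xs

  vertex-in-block : ∀ v → ∃ λ i → v ∈ Bs i
  vertex-in-block v with i , ⊆Bsᵢ ← clique⊆block {v ∷ []} (All.[] ∷ []) = i , ⊆Bsᵢ (here refl)

  edge-in-block : ∀ {u v} → Adj G u v → ∃ λ i → u ∈ Bs i × v ∈ Bs i
  edge-in-block uv with i , ⊆Bsᵢ ← clique⊆block ((uv All.∷ All.[]) ∷ All.[] ∷ []) =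
    i , ⊆Bsᵢ (here refl) , ⊆Bsᵢ (there (here refl))

  triangle-in-block : ∀ {x y z} → Adj G x y → Adj G x z → Adj G y z → ∃ λ i → x ∈ Bs i × y ∈ Bs i × z ∈ Bs i
  triangle-in-block xy xz yz with i , ⊆Bsᵢ ← clique⊆block ((xy All.∷ xz All.∷ All.[]) ∷ (yz All.∷ All.[]) ∷ All.[] ∷ []) =
    i , ⊆Bsᵢ (here refl) , ⊆Bsᵢ (there (here refl)) , ⊆Bsᵢ (there (there (here refl)))

  open CliqueCover G Bs block-complete edge-in-block public using (adj?; zfs-lower-bound)

  blocks-sharing-two-vertices : ∀ {x y i j} → x ≢ y → x ∈ Bs i → y ∈ Bs i → x ∈ Bs j → y ∈ Bs j → i ≡ j
  blocks-sharing-two-vertices {i = i} {j} x≢y x∈ᵢ y∈ᵢ x∈ⱼ y∈ⱼ = proj₁ (proj₂ blocks) i j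
    (blocks-sharing-two-vertices-coincide G (proj₁ blocks i) (proj₁ blocks j) x≢y x∈ᵢ y∈ᵢ x∈ⱼ y∈ⱼ)

  -- v followed by a simple path from a to b is a cycle, which is nonseparable and hence lies in a
  -- block, a clique.
  chord : ∀ {v a b} → Adj G v a → Adj G v b → a ≢ b → Walk G (⊤ - v) a b → Adj G a b
  chord {v} {a} {b} va vb a≢b p =
    let q , simple , q⊆p = simplify G p
        i , C⊆Bsᵢ = nonseparable⊆block G blocks (cycle-nonseparable G q simple (v∉p ∘ q⊆p) va vb)
        on-cycle : ∀ {x} → x ∈ˡ vertices G q → x ∈ Bs i
        on-cycle = C⊆Bsᵢ ∘ ∈-fromList⁺ (v ∷ vertices G q) ∘ there
    in block-complete i a b (on-cycle (start∈vertices G q)) (on-cycle (end∈vertices G q)) a≢b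
    where
    v∉p : v ∉ˡ vertices G p
    v∉p v∈p = x∈p-y⇒x≢y (vertices⊆ G (x∈p∧x≢y⇒x∈p-y ∈⊤ λ { refl → irrAdj G va }) p v∈p) refl

  module Rooted (r : Fin n) where

    Reaches : ℕ → Fin n → Set
    Reaches zero    v = v ≡ r
    Reaches (suc k) v = ∃ λ u → Adj G v u × Reaches k u

    reaches? : ∀ k v → Dec (Reaches k v)
    reaches? zero    v = v Fin.≟ r
    reaches? (suc k) v = any? (λ u → adj? v u ×-dec reaches? k u)

    walk⇒reaches : ∀ {v} → Walk G ⊤ v r → ∃ λ k → Reaches k v
    walk⇒reaches ε = 0 , refl
    walk⇒reaches ((_ , _ , vu) ◅ p) = let k , reaches = walk⇒reaches p in suc k , _ , vu , reaches

    opaque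
      shortest : ∀ v → ∃ λ k → Reaches k v × (∀ {j} → j < k → ¬ Reaches j v)
      shortest v = least (λ k → reaches? k v) (proj₂ (walk⇒reaches (proj₁ cliqueTree v r ∈⊤ ∈⊤)))

    depth : Fin n → ℕ
    depth v = proj₁ (shortest v)

    reaches-depth : ∀ v → Reaches (depth v) v
    reaches-depth v = proj₁ (proj₂ (shortest v))

    depth-minimal : ∀ {k v} → Reaches k v → depth v ≤ k
    depth-minimal {k} {v} reaches = ≮⇒≥ λ k<depth → proj₂ (proj₂ (shortest v)) k<depth reaches

    depth≡0⇒root : ∀ {v} → depth v ≡ 0 → v ≡ r
    depth≡0⇒root {v} depth≡0 = subst (λ k → Reaches k v) depth≡0 (reaches-depth v)

    depth-root : depth r ≡ 0
    depth-root = n≤0⇒n≡0 (depth-minimal {0} refl)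

    depth-edge : ∀ {u v} → Adj G u v → depth u ≤ suc (depth v)
    depth-edge {v = v} uv = depth-minimal (v , uv , reaches-depth v)

    parent : ∀ {v} → v ≢ r → ∃ λ q → Adj G v q × suc (depth q) ≡ depth v
    parent {v} v≢r with depth v | reaches-depth v | depth-edge {v}
    ... | zero  | v≡r               | _    = ⊥-elim (v≢r v≡r)
    ... | suc k | q , vq , reaches-q | edge =
      q , vq , ≤-antisym (s≤s (depth-minimal reaches-q)) (edge vq)

    descent : ∀ {x v} → x ≢ v → depth x ≤ depth v → Walk G (⊤ - v) x r
    descent {x} {v} = go (<-wellFounded (depth x))
      where
      go : ∀ {x} → Acc _<_ (depth x) → x ≢ v → depth x ≤ depth v → Walk G (⊤ - v) x r
      go {x} (acc smaller) x≢v x≤v with x Fin.≟ r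
      ... | yes refl = ε
      ... | no x≢r with q , xq , q<x ← parent x≢r =
        (x∈p∧x≢y⇒x∈p-y ∈⊤ x≢v , x∈p∧x≢y⇒x∈p-y ∈⊤ q≢v , xq) ◅ go (smaller (≤-reflexive q<x)) q≢v (<⇒≤ q<v)
        where
        q<v : depth q < depth v
        q<v = ≤-trans (≤-reflexive q<x) x≤v
        q≢v : q ≢ v
        q≢v refl = <-irrefl refl q<v

    chord-below : ∀ {v p w} → Adj G v p → Adj G v w → p ≢ w → depth p < depth v → depth w ≤ depth v →
      Adj G p w
    chord-below {v} {p} {w} vp vw p≢w p<v w≤v =
      chord vp vw p≢w (descent p≢v (<⇒≤ p<v) ◅◅ reverse (symAdjIn G) (descent w≢v w≤v))
      where
      p≢v : p ≢ v
      p≢v refl = <-irrefl refl p<v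
      w≢v : w ≢ v
      w≢v refl = irrAdj G vw

    anchor-spec : ∀ i → ∃ λ a → a ∈ Bs i × (∀ {x} → x ∈ Bs i → depth a ≤ depth x)
    anchor-spec i = argmin depth (block-nonempty G r (proj₁ blocks i))

    anchor : Fin b → Fin n
    anchor i = proj₁ (anchor-spec i)

    anchor∈ : ∀ i → anchor i ∈ Bs i
    anchor∈ i = proj₁ (proj₂ (anchor-spec i))

    anchor-lowest : ∀ i {x} → x ∈ Bs i → depth (anchor i) ≤ depth x
    anchor-lowest i = proj₂ (proj₂ (anchor-spec i))

    -- The parent of such an x would be adjacent to the anchor (chord-below), hence in block i and
    -- below its anchor.
    non-anchor-not-level : ∀ {i x} → x ∈ Bs i → x ≢ anchor i → depth x ≢ depth (anchor i)
    non-anchor-not-level {i} {x} x∈ x≢a x≡a-depth =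
      let q , xq , q<x = parent x≢r
          q<a = ≤-trans (≤-reflexive q<x) (≤-reflexive x≡a-depth)
          qa = chord-below xq xa (λ q≡a → <-irrefl (cong depth q≡a) q<a) (≤-reflexive q<x) (≤-reflexive (sym x≡a-depth))
          k , x∈ₖ , q∈ₖ , a∈ₖ = triangle-in-block xq xa qa
          k≡i = blocks-sharing-two-vertices x≢a x∈ₖ a∈ₖ x∈ (anchor∈ i)
      in <-irrefl refl (≤-<-trans (anchor-lowest i (subst (λ j → q ∈ Bs j) k≡i q∈ₖ)) q<a)
      where
      xa : Adj G x (anchor i)
      xa = block-complete i x (anchor i) x∈ (anchor∈ i) x≢a
      x≢r : x ≢ r
      x≢r refl = x≢a (sym (depth≡0⇒root (trans (sym x≡a-depth) depth-root)))

    depth-non-anchor : ∀ {i x} → x ∈ Bs i - anchor i → depth x ≡ suc (depth (anchor i))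
    depth-non-anchor {i} {x} x∈ = ≤-antisym
      (depth-edge (block-complete i x (anchor i) (x∈p-y⇒x∈p x∈) (anchor∈ i) (x∈p-y⇒x≢y x∈)))
      (≤∧≢⇒< (anchor-lowest i (x∈p-y⇒x∈p x∈)) (non-anchor-not-level (x∈p-y⇒x∈p x∈) (x∈p-y⇒x≢y x∈) ∘ sym))

    non-anchor≢root : ∀ {i x} → x ∈ Bs i - anchor i → x ≢ r
    non-anchor≢root x∈ refl = 0≢1+n (trans (sym depth-root) (depth-non-anchor x∈))

    parent-block : ∀ {v} → v ≢ r → ∃ λ i → v ∈ Bs i - anchor i
    parent-block v≢r with q , vq , q<v ← parent v≢r with i , v∈ , q∈ ← edge-in-block vq =
      i , x∈p∧x≢y⇒x∈p-y v∈ λ v≡a →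
        <-irrefl refl (≤-trans (s≤s (≤-trans (≤-reflexive (cong depth v≡a)) (anchor-lowest i q∈))) (≤-reflexive q<v))

    -- Two distinct anchors one level above x are adjacent (chord-below), so x and both anchors
    -- lie in a single block.
    parent-block-unique : ∀ {x i j} → x ∈ Bs i - anchor i → x ∈ Bs j - anchor j → i ≡ j
    parent-block-unique {x} {i} {j} x∈ᵢ x∈ⱼ with anchor i Fin.≟ anchor j
    ... | yes aᵢ≡aⱼ = blocks-sharing-two-vertices (x∈p-y⇒x≢y x∈ᵢ) (x∈p-y⇒x∈p x∈ᵢ) (anchor∈ i) (x∈p-y⇒x∈p x∈ⱼ)
                        (subst (_∈ Bs j) (sym aᵢ≡aⱼ) (anchor∈ j))
    ... | no aᵢ≢aⱼ =
      let k , x∈ₖ , aᵢ∈ₖ , aⱼ∈ₖ = triangle-in-block xaᵢ xaⱼ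
            (chord-below xaᵢ xaⱼ aᵢ≢aⱼ (≤-reflexive (sym (depth-non-anchor x∈ᵢ)))
                                        (≤-trans (n≤1+n _) (≤-reflexive (sym (depth-non-anchor x∈ⱼ)))))
      in trans (blocks-sharing-two-vertices (x∈p-y⇒x≢y x∈ᵢ) (x∈p-y⇒x∈p x∈ᵢ) (anchor∈ i) x∈ₖ aᵢ∈ₖ)
               (sym (blocks-sharing-two-vertices (x∈p-y⇒x≢y x∈ⱼ) (x∈p-y⇒x∈p x∈ⱼ) (anchor∈ j) x∈ₖ aⱼ∈ₖ))
      where
      xaᵢ : Adj G x (anchor i)
      xaᵢ = block-complete i x (anchor i) (x∈p-y⇒x∈p x∈ᵢ) (anchor∈ i) (x∈p-y⇒x≢y x∈ᵢ)
      xaⱼ : Adj G x (anchor j)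
      xaⱼ = block-complete j x (anchor j) (x∈p-y⇒x∈p x∈ⱼ) (anchor∈ j) (x∈p-y⇒x≢y x∈ⱼ)

  module UpperBound (large : ∀ i → 3 ≤ ∣ Bs i ∣) (r : Fin n) where

    open Rooted r

    two-non-anchors : ∀ i → ∃₂ λ f w → f ∈ Bs i - anchor i × w ∈ Bs i - anchor i × f ≢ w
    two-non-anchors i =
      let 2≤∣Bsᵢ-a∣ = suc≤∣p∣⇒≤∣p-x∣ (Bs i) (anchor i) (large i)
          w , w∈ = nonempty (Bs i - anchor i) (≤-trans (s≤s z≤n) 2≤∣Bsᵢ-a∣)
          f , f∈ = nonempty (Bs i - anchor i - w) (suc≤∣p∣⇒≤∣p-x∣ (Bs i - anchor i) w 2≤∣Bsᵢ-a∣)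
      in f , w , x∈p-y⇒x∈p f∈ , w∈ , x∈p-y⇒x≢y f∈

    forcer white : Fin b → Fin n
    forcer i = proj₁ (two-non-anchors i)
    white  i = proj₁ (proj₂ (two-non-anchors i))

    forcer∈ : ∀ i → forcer i ∈ Bs i - anchor i
    forcer∈ i = proj₁ (proj₂ (proj₂ (two-non-anchors i)))

    white∈ : ∀ i → white i ∈ Bs i - anchor i
    white∈ i = proj₁ (proj₂ (proj₂ (proj₂ (two-non-anchors i))))

    forcer≢white : ∀ i → forcer i ≢ white i
    forcer≢white i = proj₂ (proj₂ (proj₂ (proj₂ (two-non-anchors i))))

    whites : Subset n
    whites = fromList (List.tabulate white)

    white∈whites : ∀ i → white i ∈ whites
    white∈whites i = ∈-fromList⁺ (List.tabulate white) (∈-tabulate⁺ i)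

    white-injective : ∀ {i j} → white i ≡ white j → i ≡ j
    white-injective {i} {j} wᵢ≡wⱼ = parent-block-unique (white∈ i) (subst (_∈ Bs j - anchor j) (sym wᵢ≡wⱼ) (white∈ j))

    S : Subset n
    S = ∁ whites

    non-white∈S : ∀ {x} → (∀ j → x ≢ white j) → x ∈ S
    non-white∈S x≢whites = x∉p⇒x∈∁p λ x∈whites →
      let j , x≡wⱼ = ∈-tabulate⁻ (∈-fromList⁻ (List.tabulate white) x∈whites) in x≢whites j x≡wⱼ

    non-anchor∈S : ∀ {i x} → x ∈ Bs i - anchor i → x ≢ white i → x ∈ S
    non-anchor∈S {i} x∈ x≢wᵢ = non-white∈S λ j x≡wⱼ →
      x≢wᵢ (trans x≡wⱼ (cong white (parent-block-unique (subst (_∈ Bs j - anchor j) (sym x≡wⱼ) (white∈ j)) x∈)))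

    root∈S : r ∈ S
    root∈S = non-white∈S λ j r≡wⱼ → non-anchor≢root (white∈ j) (sym r≡wⱼ)

    ∣S∣+b≤n : ∣ S ∣ + b ≤ n
    ∣S∣+b≤n = begin
      ∣ S ∣ + b                     ≡⟨ cong (_+ b) (∣∁p∣≡n∸∣p∣ whites) ⟩
      n ∸ ∣ whites ∣ + b            ≤⟨ +-monoʳ-≤ (n ∸ ∣ whites ∣) (injective⇒≤∣p∣ white white-injective white∈whites) ⟩
      n ∸ ∣ whites ∣ + ∣ whites ∣   ≡⟨ m∸n+n≡m (∣p∣≤n whites) ⟩
      n                             ∎
      where open ≤-Reasoning

    BlockBlue : Fin b → Set
    BlockBlue i = ∀ {x} → x ∈ Bs i → Blue G ⊤ S x

    forcer-neighbours-blue : ∀ i → Blue G ⊤ S (anchor i) → (∀ k → anchor k ≡ forcer i → BlockBlue k) →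
      ∀ w → AdjIn G ⊤ (forcer i) w → w ≢ white i → Blue G ⊤ S w
    forcer-neighbours-blue i anchor-blue children-blue w (_ , _ , fw) w≢wᵢ
      with k , f∈ₖ , w∈ₖ ← edge-in-block fw
      with k Fin.≟ i | forcer i Fin.≟ anchor k | w Fin.≟ anchor i
    ... | yes refl | _ | yes refl = anchor-blue
    ... | yes refl | _ | no w≢a   = initial (non-anchor∈S (x∈p∧x≢y⇒x∈p-y w∈ₖ w≢a) w≢wᵢ)
    ... | no _   | yes f≡aₖ | _   = children-blue k (sym f≡aₖ) w∈ₖ
    ... | no k≢i | no f≢aₖ  | _   = ⊥-elim (k≢i (parent-block-unique (x∈p∧x≢y⇒x∈p-y f∈ₖ f≢aₖ) (forcer∈ i)))

    block-blue-step : ∀ i → Blue G ⊤ S (anchor i) → (∀ k → anchor k ≡ forcer i → BlockBlue k) → BlockBlue i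
    block-blue-step i anchor-blue children-blue {x} x∈ with x Fin.≟ anchor i | x Fin.≟ white i
    ... | yes refl | _        = anchor-blue
    ... | no x≢a   | no x≢wᵢ  = initial (non-anchor∈S (x∈p∧x≢y⇒x∈p-y x∈ x≢a) x≢wᵢ)
    ... | no _     | yes refl = force (initial (non-anchor∈S (forcer∈ i) (forcer≢white i)))
      (∈⊤ , ∈⊤ , block-complete i (forcer i) x (x∈p-y⇒x∈p (forcer∈ i)) x∈ (forcer≢white i))
      (forcer-neighbours-blue i anchor-blue children-blue)

    -- The blocks anchored at forcer i have deeper anchors, and D bounds every depth.
    block-blue : ∀ i → Blue G ⊤ S (anchor i) → BlockBlue i
    block-blue i = go i (<-wellFounded _)
      where
      D : ℕ
      D = Σ[ n ] depth
      go : ∀ i → Acc _<_ (D ∸ depth (anchor i)) → Blue G ⊤ S (anchor i) → BlockBlue i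
      go i (acc smaller) anchor-blue = block-blue-step i anchor-blue λ k aₖ≡f →
        go k (smaller (∸-monoʳ-< (deeper k aₖ≡f) (f≤Σ depth (anchor k))))
             (subst (Blue G ⊤ S) (sym aₖ≡f) (initial (non-anchor∈S (forcer∈ i) (forcer≢white i))))
        where
        deeper : ∀ k → anchor k ≡ forcer i → depth (anchor i) < depth (anchor k)
        deeper k aₖ≡f = ≤-reflexive (sym (trans (cong depth aₖ≡f) (depth-non-anchor (forcer∈ i))))

    all-blue : ∀ v → Blue G ⊤ S v
    all-blue v = go v (<-wellFounded (depth v))
      where
      go : ∀ v → Acc _<_ (depth v) → Blue G ⊤ S v
      go v (acc smaller) with v Fin.≟ r
      ... | yes refl = initial root∈S
      ... | no v≢r with i , v∈ ← parent-block v≢r =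
        block-blue i (go (anchor i) (smaller (≤-reflexive (sym (depth-non-anchor v∈))))) (x∈p-y⇒x∈p v∈)

    zfs-upper-bound : ∃ λ S → IsZFS G ⊤ S × ∣ S ∣ + b ≤ n
    zfs-upper-bound = S , ((λ _ → ∈⊤) , λ v _ → all-blue v) , ∣S∣+b≤n

  Z-clique-tree : (∀ i → 3 ≤ ∣ Bs i ∣) → ∀ {z} → IsZ G ⊤ z → z + b ≡ n
  Z-clique-tree large ((S₀ , zfs₀ , refl) , minimal) = ≤-antisym upper (zfs-lower-bound zfs₀)
    where
    upper : ∣ S₀ ∣ + b ≤ n
    upper with fin-or-zero n | fin-or-zero b
    ... | inj₁ r | _ = let S , zfs , ∣S∣+b≤n = UpperBound.zfs-upper-bound large r in
      ≤-trans (+-monoˡ-≤ b (minimal S zfs)) ∣S∣+b≤n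
    ... | inj₂ refl | inj₂ refl = ≤-reflexive (+-identityʳ ∣ S₀ ∣) ⟨ ≤-trans ⟩ ∣p∣≤n S₀
    ... | inj₂ refl | inj₁ i = case ≤-trans (large i) (∣p∣≤n (Bs i)) of λ ()

mainTheorem3 : ∀ {n b} (G : Graph n) (Bs : Fin b → Subset n) →
    IsCliqueTree G → BlocksOf G Bs → (∀ i → 3 ≤ ∣ Bs i ∣) →
    ∀ (z : ℕ) (zs : Fin b → ℕ) → IsZ G ⊤ z → (∀ i → IsZ G (Bs i) (zs i)) →
    z + Σ[ n ] (λ v → blockIndex Bs v ∸ 1) ≡ Σ[ b ] zs
mainTheorem3 {n} {b} G Bs cliqueTree blocks large z zs Z Zs = +-cancelʳ-≡ b _ _ $ begin
  z + X + b                 ≡⟨ xy∙z≈y∙xz z X b ⟩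
  X + (z + b)               ≡⟨ cong (X +_) (Z-clique-tree large Z) ⟩
  X + n                     ≡⟨ Σ-∸1 (blockIndex Bs) (λ v → 1≤blockIndex Bs (proj₂ (vertex-in-block v))) ⟩
  Σ[ n ] (blockIndex Bs)    ≡⟨ Σ-blockIndex Bs ⟩
  Σ[ b ] (λ i → ∣ Bs i ∣)   ≡⟨ Σ-cong (λ i → sym (Z-complete G (block-complete i) (≤-trans (n≤1+n 2) (large i)) (Zs i))) ⟩
  Σ[ b ] (λ i → suc (zs i)) ≡⟨ Σ-suc zs ⟩
  Σ[ b ] zs + b             ∎
  where
  open CliqueTree G Bs cliqueTree blocks
  open ≡-Reasoning
  X : ℕ
  X = Σ[ n ] (λ v → blockIndex Bs v ∸ 1)
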